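{- Let $\mathbf{h}$ be a weakly increasing sequence of positive integers with $\mathbf{h}(i)>i$ for all $i$, let $S$ be a nonempty $\mathbf{h}$-admissible set, $m=\mathbf{m}(S)$, $n\ge\mathbf{h}(m)$, and $k$ with $\mathbf{h}(m)-m\le k\le\mathbf{h}(m)$. If $\pi\in B_k(S,n)$, then $$\ell(\pi)=\ell(\pi|_{\mathbf{h}(m)})+\ell_{[k+1,n]}\big([k+1,n]\setminus\{\pi_{\mathbf{h}(m)+1},\dots,\pi_n\}\big).$$
   Context: $\mathcal{P}_\mathbf{h}=\{(i,j): i<j\le \mathbf{h}(i)\}$. For $\pi\in S_n$, $\mathrm{inv}_\mathbf{h}(\pi)=\{(i,j)\in\mathcal{P}_\mathbf{h}: j\le n,\ \pi_i>\pi_j\}$. $S$ is $\mathbf{h}$-admissible if $S=\mathrm{inv}_\mathbf{h}(\pi)$ for some permutation $\pi$. $\mathbf{m}(S)=\max\{i:(i,i+1)\in S\}$. $B_k(S,n)=\{\pi\in S_n:\mathrm{inv}_\mathbf{h}(\pi)=S,\ \pi_{\mathbf{h}(m)}=k\}$. $\ell(\sigma)$ is the number of inversions (pairs $i<j$ with $\sigma_i>\sigma_j$) of $\sigma$. $\pi|_r$ is the flattening: the permutation of $[r]$ in the same relative order as $\pi_1,\dots,\pi_r$. For $A\subseteq[a,b]=\{a,\dots,b\}$, $\ell_{[a,b]}(A)=\#\{(x,y)\in[a,b]^2: x>y,\ x\in A,\ y\notin A\}$. -}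

module Defs where

open import Data.Nat using (ℕ; zero; suc; _+_; _∸_; _≤_; _<_; _<?_; _≤?_; _≟_)
open import Data.Fin using (Fin; toℕ; fromℕ<)
open import Data.Fin.Permutation using (Permutation′; _⟨$⟩ʳ_)
open import Data.List using (List; []; _∷_; map; filter; length)
open import Data.Nat.ListAction using (sum)
open import Data.List.Relation.Unary.Any using (any?)
open import Data.Bool using (Bool; true; false; T)
open import Data.Product using (_×_; Σ)
open import Relation.Binary.PropositionalEquality using (_≡_)
open import Relation.Nullary using (¬_)
open import Relation.Nullary.Decidable using (⌊_⌋; _×-dec_; ¬?)
open import Function.Bundles using (_⇔_)
import Data.Bool

-- Conventions: positions and values are 1-indexed natural numbers.

interval : ℕ → ℕ → List ℕ
interval a b = go a (suc b ∸ a)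
  where
  go : ℕ → ℕ → List ℕ
  go x zero = []
  go x (suc c) = x ∷ go (suc x) c

-- one-line notation of a permutation π ∈ S_n: seq π i = π_i for 1 ≤ i ≤ n,
-- and 0 outside [1,n]
seq : {n : ℕ} → Permutation′ n → ℕ → ℕ
seq {n} π zero = 0
seq {n} π (suc i) with i <? n
... | Relation.Nullary.yes p = suc (toℕ (π ⟨$⟩ʳ fromℕ< p))
... | Relation.Nullary.no _ = 0

len : ℕ → (ℕ → ℕ) → ℕ
len r σ = sum (map (λ i → length (filter (λ j → σ j <? σ i) (interval (suc i) r)))
                   (interval 1 r))

-- flattening σ|_r: the sequence of [r] in the same relative order as σ_1 … σ_r
-- (σ|_r)_i = #{ j ∈ [1,r] : σ_j ≤ σ_i }
flatten : (ℕ → ℕ) → ℕ → ℕ → ℕ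
flatten σ r i = length (filter (λ j → σ j ≤? σ i) (interval 1 r))

-- ℓ_{[a,b]}(A) = #{(x,y) ∈ [a,b]² : x > y, x ∈ A, y ∉ A}, A given by its
-- (Boolean) characteristic function
lenInt : ℕ → ℕ → (ℕ → Bool) → ℕ
lenInt a b A =
  sum (map (λ x → length (filter (λ y → (A x Data.Bool.≟ true) ×-dec
                                         ((A y Data.Bool.≟ false) ×-dec (y <? x)))
                                 (interval a b)))
           (interval a b))

-- the set inv_h(π) (as a predicate on pairs (i,j)) for a sequence σ of length n:
-- (i,j) ∈ P_h (i.e. i < j ≤ h(i)), j ≤ n and σ_i > σ_j
InvH : (ℕ → ℕ) → ℕ → (ℕ → ℕ) → ℕ → ℕ → Set
InvH h n σ i j = (1 ≤ i) × (i < j) × (j ≤ h i) × (j ≤ n) × (σ j < σ i)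

InvEq : (ℕ → ℕ) → (S : ℕ → ℕ → Set) → (n : ℕ) → Permutation′ n → Set
InvEq h S n π = ∀ i j → S i j ⇔ InvH h n (seq π) i j

Admissible : (ℕ → ℕ) → (ℕ → ℕ → Set) → Set
Admissible h S = Σ ℕ λ N → Σ (Permutation′ N) λ σ → InvEq h S N σ

IsMS : (ℕ → ℕ → Set) → ℕ → Set
IsMS S m = S m (suc m) × (∀ i → S i (suc i) → i ≤ m)

IsHessenberg : (ℕ → ℕ) → Set
IsHessenberg h = (∀ i j → 1 ≤ i → i ≤ j → h i ≤ h j) × (∀ i → 1 ≤ i → i < h i)

InB : (h : ℕ → ℕ) → (S : ℕ → ℕ → Set) → (m k n : ℕ) → Permutation′ n → Set
InB h S m k n π = InvEq h S n π × (seq π (h m) ≡ k)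

tailCompl : (σ : ℕ → ℕ) → (p k n : ℕ) → ℕ → Bool
tailCompl σ p k n x =
  ⌊ (suc k ≤? x) ×-dec ((x ≤? n) ×-dec (¬? (any? (λ j → σ j ≟ x) (interval (suc p) n)))) ⌋

{-# OPTIONS --safe #-}
-- No adjacent pair of positions beyond m = m(S) is an inversion of π, and all
-- of them lie in P_h, so π increases from position m + 1 on; in particular
-- k = π_{h(m)} < π_{h(m)+1} < … < π_n. Hence the inversions of π are those among
-- the first h(m) positions, counted by ℓ(π|_{h(m)}), plus the pairs
-- i ≤ h(m) < j with π_j < π_i. Grouped by the value x = π_i, which ranges over
-- the values outside V = {π_{h(m)+1}, …, π_n}, these number
-- Σ_{x ∉ V} #{y ∈ V : y < x}. Since V ⊆ [k+1, n], only the x in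
-- A = [k+1, n] ∖ V contribute, and the sum is ℓ_{[k+1,n]}(A).
module Submission where

open import Defs
open import Data.Nat
open import Data.Nat.Properties
open import Data.Nat.ListAction using (sum)
open import Data.Nat.ListAction.Properties using (sum-++)
open import Data.Bool using (Bool; true; false; if_then_else_) renaming (_≟_ to _≟ᵇ_)
open import Data.Fin using (Fin; toℕ; fromℕ<)
open import Data.Fin.Properties using (toℕ<n; fromℕ<-toℕ; fromℕ<-injective; toℕ-injective)
open import Data.Fin.Permutation using (Permutation′; _⟨$⟩ʳ_)
open import Data.List using (List; []; _∷_; _++_; map; filter; length; iterate)
open import Data.List.Properties using (map-++; filter-++; length-++; filter-none)
open import Data.List.Membership.Propositional using (_∈_; lose; find)
open import Data.List.Relation.Unary.Any using (Any; here; there; any?)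
import Data.List.Relation.Unary.All as All
open import Data.Product using (_×_; _,_; proj₁; proj₂; Σ)
open import Data.Sum using (inj₁; inj₂)
open import Algebra.Properties.CommutativeMonoid.Sum +-0-commutativeMonoid as Σ-Fin
  using (sum-permute; sum-cong-≗)
open import Algebra.Properties.CommutativeSemigroup +-commutativeSemigroup using (interchange)
open import Function using (_∘_)
open import Function.Bundles using (Injection; Equivalence; _⇔_; mk⇔)
open import Function.Properties.Inverse using (↔⇒↣)
open import Relation.Binary.PropositionalEquality
open import Relation.Nullary using (¬_; Dec; yes; no; does; contradiction)
open import Relation.Nullary.Decidable
  using (isYes≗does; dec-true; dec-false; decidable-stable; _×-dec_; ¬?)
open import Relation.Unary using (Pred; Decidable)

iterate-unique : ∀ {a} {A : Set a} (f : A → A) {F : A → ℕ → List A} →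
                 (∀ x → F x 0 ≡ []) → (∀ x c → F x (suc c) ≡ x ∷ F (f x) c) →
                 ∀ x c → F x c ≡ iterate f x c
iterate-unique f {F} F0 Fsuc x zero    = F0 x
iterate-unique f {F} F0 Fsuc x (suc c) =
  trans (Fsuc x c) (cong (x ∷_) (iterate-unique f {F} F0 Fsuc (f x) c))

interval≡iterate : ∀ a b → interval (suc a) b ≡ iterate suc (suc a) (b ∸ a)
interval≡iterate a b = unfold
  where
  -- `interval` counts with a function local to its `where` block, which cannot
  -- be named here: `_` stands for it and is solved from the use in `unfold`,
  -- where `with suc (suc a)` makes its arguments distinct variables.
  local≡iterate : ∀ x c → _ ≡ iterate suc x c
  local≡iterate = iterate-unique suc (λ _ → refl) (λ _ _ → refl)

  unfold : interval (suc a) b ≡ iterate suc (suc a) (b ∸ a)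
  unfold with b ∸ a
  ... | zero  = refl
  ... | suc c with suc (suc a)
  ...   | a′ = cong (suc a ∷_) (local≡iterate a′ c)

∈-iterate⁻ : ∀ {a c y} → y ∈ iterate suc a c → a ≤ y × y < a + c
∈-iterate⁻ {a} {suc c}     (here refl) = ≤-refl , m<m+n a z<s
∈-iterate⁻ {a} {suc c} {y} (there y∈) with ∈-iterate⁻ y∈
... | a<y , y<1+a+c = <⇒≤ a<y , subst (y <_) (sym (+-suc a c)) y<1+a+c

∈-iterate⁺ : ∀ {a c y} → a ≤ y → y < a + c → y ∈ iterate suc a c
∈-iterate⁺ {a} {zero}  {y} a≤y y<a+0 = contradiction (subst (y <_) (+-identityʳ a) y<a+0) (≤⇒≯ a≤y)
∈-iterate⁺ {a} {suc c} {y} a≤y y<a+1+c with m≤n⇒m<n∨m≡n a≤y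
... | inj₂ refl = here refl
... | inj₁ a<y  = there (∈-iterate⁺ a<y (subst (y <_) (+-suc a c) y<a+1+c))

iterate-++ : ∀ a c d → iterate suc a (c + d) ≡ iterate suc a c ++ iterate suc (a + c) d
iterate-++ a zero    d = cong (λ a′ → iterate suc a′ d) (sym (+-identityʳ a))
iterate-++ a (suc c) d = cong (a ∷_) (trans (iterate-++ (suc a) c d) tail-start)
  where
  tail-start : iterate suc (suc a) c ++ iterate suc (suc a + c) d ≡ iterate suc (suc a) c ++ iterate suc (a + suc c) d
  tail-start = cong (λ a′ → iterate suc (suc a) c ++ iterate suc a′ d) (sym (+-suc a c))

∈-interval⁻ : ∀ {a b y} → y ∈ interval (suc a) b → a < y × y ≤ b
∈-interval⁻ {a} {b} {y} y∈ with ∈-iterate⁻ (subst (y ∈_) (interval≡iterate a b) y∈) | a ≤? b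
... | a<y , y<1+a+[b∸a] | yes a≤b = a<y , ≤-pred (subst (y <_) (cong suc (m+[n∸m]≡n a≤b)) y<1+a+[b∸a])
... | a<y , y<1+a+[b∸a] | no a≰b  = contradiction y≤a (<⇒≱ a<y)
  where
  y≤a : y ≤ a
  y≤a = subst (y ≤_) (trans (cong (a +_) (m≤n⇒m∸n≡0 (<⇒≤ (≰⇒> a≰b)))) (+-identityʳ a))
                     (≤-pred y<1+a+[b∸a])

∈-interval⁺ : ∀ {a b y} → a < y → y ≤ b → y ∈ interval (suc a) b
∈-interval⁺ {a} {b} {y} a<y y≤b = subst (y ∈_) (sym (interval≡iterate a b)) (∈-iterate⁺ a<y y<1+a+[b∸a])
  where
  y<1+a+[b∸a] : y < suc a + (b ∸ a)
  y<1+a+[b∸a] = subst (y <_) (cong suc (sym (m+[n∸m]≡n (<⇒≤ (<-≤-trans a<y y≤b))))) (s≤s y≤b)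

interval-++ : ∀ {a b c} → a ≤ b → b ≤ c →
              interval (suc a) c ≡ interval (suc a) b ++ interval (suc b) c
interval-++ {a} {b} {c} a≤b b≤c = begin
  interval (suc a) c
    ≡⟨ interval≡iterate a c ⟩
  iterate suc (suc a) (c ∸ a)
    ≡⟨ cong (iterate suc (suc a)) c∸a≡[b∸a]+[c∸b] ⟩
  iterate suc (suc a) ((b ∸ a) + (c ∸ b))
    ≡⟨ iterate-++ (suc a) (b ∸ a) (c ∸ b) ⟩
  iterate suc (suc a) (b ∸ a) ++ iterate suc (suc a + (b ∸ a)) (c ∸ b)
    ≡⟨ cong (λ b′ → iterate suc (suc a) (b ∸ a) ++ iterate suc (suc b′) (c ∸ b)) (m+[n∸m]≡n a≤b) ⟩
  iterate suc (suc a) (b ∸ a) ++ iterate suc (suc b) (c ∸ b)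
    ≡⟨ cong₂ _++_ (interval≡iterate a b) (interval≡iterate b c) ⟨
  interval (suc a) b ++ interval (suc b) c
    ∎
  where
  open ≡-Reasoning
  c∸a≡[b∸a]+[c∸b] : c ∸ a ≡ (b ∸ a) + (c ∸ b)
  c∸a≡[b∸a]+[c∸b] = trans (cong (_∸ a) (sym (m+[n∸m]≡n b≤c))) (+-∸-comm (c ∸ b) a≤b)

module _ {a} {A : Set a} where

  sum-map-cong : ∀ {f g : A → ℕ} xs → (∀ {x} → x ∈ xs → f x ≡ g x) → sum (map f xs) ≡ sum (map g xs)
  sum-map-cong []       f≗g = refl
  sum-map-cong (x ∷ xs) f≗g = cong₂ _+_ (f≗g (here refl)) (sum-map-cong xs (f≗g ∘ there))

  sum-map-zero : ∀ {f : A → ℕ} xs → (∀ {x} → x ∈ xs → f x ≡ 0) → sum (map f xs) ≡ 0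
  sum-map-zero []       f≗0 = refl
  sum-map-zero (x ∷ xs) f≗0 = cong₂ _+_ (f≗0 (here refl)) (sum-map-zero xs (f≗0 ∘ there))

  sum-map-++ : ∀ (f : A → ℕ) xs ys → sum (map f (xs ++ ys)) ≡ sum (map f xs) + sum (map f ys)
  sum-map-++ f xs ys = trans (cong sum (map-++ f xs ys)) (sum-++ (map f xs) (map f ys))

  sum-map-+ : ∀ (f g : A → ℕ) xs → sum (map (λ x → f x + g x) xs) ≡ sum (map f xs) + sum (map g xs)
  sum-map-+ f g []       = refl
  sum-map-+ f g (x ∷ xs) = trans (cong (f x + g x +_) (sum-map-+ f g xs)) (interchange (f x) (g x) _ _)

count : ∀ {a p} {A : Set a} {P : Pred A p} → Decidable P → List A → ℕ
count P? xs = length (filter P? xs)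

indicator : ∀ {p} {P : Set p} → Dec P → ℕ
indicator P? = if does P? then 1 else 0

indicator-reject : ∀ {p} {P : Set p} (P? : Dec P) → ¬ P → indicator P? ≡ 0
indicator-reject P? ¬P = cong (if_then 1 else 0) (dec-false P? ¬P)

module _ {a p} {A : Set a} {P : Pred A p} (P? : Decidable P) where

  count-++ : ∀ xs ys → count P? (xs ++ ys) ≡ count P? xs + count P? ys
  count-++ xs ys = trans (cong length (filter-++ P? xs ys)) (length-++ (filter P? xs))

  count-zero : ∀ xs → (∀ {x} → x ∈ xs → ¬ P x) → count P? xs ≡ 0
  count-zero xs ¬P = cong length (filter-none P? (All.tabulate ¬P))

  count≡sum-indicator : ∀ xs → count P? xs ≡ sum (map (indicator ∘ P?) xs)
  count≡sum-indicator []       = refl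
  count≡sum-indicator (x ∷ xs) with does (P? x)
  ... | true  = cong suc (count≡sum-indicator xs)
  ... | false = count≡sum-indicator xs

module _ {a p q} {A : Set a} {P : Pred A p} {Q : Pred A q} (P? : Decidable P) (Q? : Decidable Q) where

  count-cong : ∀ xs → (∀ {x} → x ∈ xs → P x ⇔ Q x) → count P? xs ≡ count Q? xs
  count-cong []       P⇔Q = refl
  count-cong (x ∷ xs) P⇔Q with P? x | Q? x
  ... | yes Px | yes Qx = cong suc (count-cong xs (P⇔Q ∘ there))
  ... | no ¬Px | no ¬Qx = count-cong xs (P⇔Q ∘ there)
  ... | yes Px | no ¬Qx = contradiction (Equivalence.to (P⇔Q (here refl)) Px) ¬Qx
  ... | no ¬Px | yes Qx = contradiction (Equivalence.from (P⇔Q (here refl)) Qx) ¬Px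

  count-mono : (∀ {x} → P x → Q x) → ∀ xs → count P? xs ≤ count Q? xs
  count-mono P⇒Q []       = z≤n
  count-mono P⇒Q (x ∷ xs) with P? x | Q? x
  ... | yes Px | yes Qx = s≤s (count-mono P⇒Q xs)
  ... | no ¬Px | no ¬Qx = count-mono P⇒Q xs
  ... | yes Px | no ¬Qx = contradiction (P⇒Q Px) ¬Qx
  ... | no ¬Px | yes Qx = m≤n⇒m≤1+n (count-mono P⇒Q xs)

  count-mono-< : (∀ {x} → P x → Q x) → ∀ {z xs} → z ∈ xs → ¬ P z → Q z → count P? xs < count Q? xs
  count-mono-< P⇒Q {xs = x ∷ xs} (here refl) ¬Pz Qz with P? x | Q? x
  ... | yes Px | _      = contradiction Px ¬Pz
  ... | no _   | no ¬Qx = contradiction Qz ¬Qx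
  ... | no _   | yes _  = s≤s (count-mono P⇒Q xs)
  count-mono-< P⇒Q {xs = x ∷ xs} (there z∈) ¬Pz Qz with P? x | Q? x
  ... | yes Px | yes Qx = s≤s (count-mono-< P⇒Q z∈ ¬Pz Qz)
  ... | no ¬Px | no ¬Qx = count-mono-< P⇒Q z∈ ¬Pz Qz
  ... | yes Px | no ¬Qx = contradiction (P⇒Q Px) ¬Qx
  ... | no ¬Px | yes Qx = m<n⇒m<1+n (count-mono-< P⇒Q z∈ ¬Pz Qz)

module _ (f : ℕ → ℕ) {a b c : ℕ} (a≤b : a ≤ b) (b≤c : b ≤ c) where

  private
    sum-map-interval-++ :
      sum (map f (interval (suc a) c)) ≡ sum (map f (interval (suc a) b)) + sum (map f (interval (suc b) c))
    sum-map-interval-++ =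
      trans (cong (sum ∘ map f) (interval-++ a≤b b≤c)) (sum-map-++ f (interval (suc a) b) (interval (suc b) c))

  sum-map-interval-dropˡ : (∀ {x} → x ∈ interval (suc a) b → f x ≡ 0) →
                           sum (map f (interval (suc a) c)) ≡ sum (map f (interval (suc b) c))
  sum-map-interval-dropˡ f≡0 = trans sum-map-interval-++ (cong (_+ _) (sum-map-zero _ f≡0))

  sum-map-interval-dropʳ : (∀ {x} → x ∈ interval (suc b) c → f x ≡ 0) →
                           sum (map f (interval (suc a) c)) ≡ sum (map f (interval (suc a) b))
  sum-map-interval-dropʳ f≡0 =
    trans sum-map-interval-++ (trans (cong (_ +_) (sum-map-zero _ f≡0)) (+-identityʳ _))

sum-map-iterate : ∀ (f : ℕ → ℕ) a c → sum (map f (iterate suc a c)) ≡ Σ-Fin.sum (λ (j : Fin c) → f (a + toℕ j))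
sum-map-iterate f a zero    = refl
sum-map-iterate f a (suc c) =
  cong₂ _+_ (cong f (sym (+-identityʳ a)))
            (trans (sum-map-iterate f (suc a) c) (sum-cong-≗ {c} (λ j → cong f (sym (+-suc a (toℕ j))))))

module _ {n} (π : Permutation′ n) where

  seq-fromℕ< : ∀ {i} (i<n : i < n) → seq π (suc i) ≡ suc (toℕ (π ⟨$⟩ʳ fromℕ< i<n))
  seq-fromℕ< {i} i<n with i <? n
  ... | yes _   = refl
  ... | no  i≮n = contradiction i<n i≮n

  seq-injective : ∀ {i j} → 0 < i → i ≤ n → 0 < j → j ≤ n → seq π i ≡ seq π j → i ≡ j
  seq-injective {suc i} {suc j} _ i<n _ j<n σi≡σj rewrite seq-fromℕ< i<n | seq-fromℕ< j<n =
    cong suc (fromℕ<-injective i j i<n j<n (Injection.injective (↔⇒↣ π) (toℕ-injective (suc-injective σi≡σj))))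

  sum-map-seq : ∀ (f : ℕ → ℕ) → sum (map (f ∘ seq π) (interval 1 n)) ≡ sum (map f (interval 1 n))
  sum-map-seq f = begin
    sum (map (f ∘ seq π) (interval 1 n))            ≡⟨ sum-map-interval (f ∘ seq π) ⟩
    Σ-Fin.sum {n} (λ j → f (seq π (suc (toℕ j))))   ≡⟨ sum-cong-≗ {n} (cong f ∘ seq-suc-toℕ) ⟩
    Σ-Fin.sum {n} (λ j → f (suc (toℕ (π ⟨$⟩ʳ j))))  ≡⟨ sum-permute (f ∘ suc ∘ toℕ) π ⟨
    Σ-Fin.sum {n} (λ j → f (suc (toℕ j)))           ≡⟨ sum-map-interval f ⟨
    sum (map f (interval 1 n))                      ∎
    where
    open ≡-Reasoning
    sum-map-interval : ∀ (g : ℕ → ℕ) → sum (map g (interval 1 n)) ≡ Σ-Fin.sum (λ (j : Fin n) → g (suc (toℕ j)))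
    sum-map-interval g = trans (cong (sum ∘ map g) (interval≡iterate 0 n)) (sum-map-iterate g 1 n)
    seq-suc-toℕ : ∀ (j : Fin n) → seq π (suc (toℕ j)) ≡ suc (toℕ (π ⟨$⟩ʳ j))
    seq-suc-toℕ j = trans (seq-fromℕ< (toℕ<n j)) (cong (suc ∘ toℕ ∘ (π ⟨$⟩ʳ_)) (fromℕ<-toℕ j (toℕ<n j)))

inversionsWith : (ℕ → ℕ) → ℕ → List ℕ → ℕ
inversionsWith σ i js = count (λ j → σ j <? σ i) js

len-split-increasing-tail :
  ∀ σ {p n} → p ≤ n → (∀ {i j} → p < i → i < j → j ≤ n → σ i < σ j) →
  len n σ ≡ len p σ + sum (map (λ i → inversionsWith σ i (interval (suc p) n)) (interval 1 p))
len-split-increasing-tail σ {p} {n} p≤n increasing = begin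
  sum (map (row n) (interval 1 n))                                 ≡⟨ sum-map-interval-dropʳ (row n) z≤n p≤n no-tail-row ⟩
  sum (map (row n) (interval 1 p))                                 ≡⟨ sum-map-cong (interval 1 p) split-row ⟩
  sum (map (λ i → row p i + inversionsWith σ i T) (interval 1 p))  ≡⟨ sum-map-+ (row p) (λ i → inversionsWith σ i T)
                                                                                   (interval 1 p) ⟩
  len p σ + sum (map (λ i → inversionsWith σ i T) (interval 1 p))  ∎
  where
  open ≡-Reasoning
  T : List ℕ
  T = interval (suc p) n
  row : ℕ → ℕ → ℕ
  row r i = inversionsWith σ i (interval (suc i) r)
  no-tail-row : ∀ {i} → i ∈ T → row n i ≡ 0
  no-tail-row i∈T = count-zero _ _ λ j∈ σj<σi →
    let p<i , _ = ∈-interval⁻ i∈T ; i<j , j≤n = ∈-interval⁻ j∈ in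
    <⇒≱ σj<σi (<⇒≤ (increasing p<i i<j j≤n))
  split-row : ∀ {i} → i ∈ interval 1 p → row n i ≡ row p i + inversionsWith σ i T
  split-row {i} i∈ = trans (cong (inversionsWith σ i) (interval-++ (proj₂ (∈-interval⁻ i∈)) p≤n))
                           (count-++ (λ j → σ j <? σ i) (interval (suc i) p) T)

module _ (σ : ℕ → ℕ) (r : ℕ) where

  flatten-mono-≤ : ∀ {i j} → σ i ≤ σ j → flatten σ r i ≤ flatten σ r j
  flatten-mono-≤ σi≤σj = count-mono _ _ (λ σl≤σi → ≤-trans σl≤σi σi≤σj) (interval 1 r)

  flatten-mono-< : ∀ {i j} → 0 < i → i ≤ r → σ j < σ i → flatten σ r j < flatten σ r i
  flatten-mono-< 0<i i≤r σj<σi =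
    count-mono-< _ _ (λ σl≤σj → ≤-trans σl≤σj (<⇒≤ σj<σi)) (∈-interval⁺ 0<i i≤r) (<⇒≱ σj<σi) ≤-refl

  flatten-<⇔ : ∀ {i j} → 0 < i → i ≤ r → flatten σ r j < flatten σ r i ⇔ σ j < σ i
  flatten-<⇔ 0<i i≤r = mk⇔ (λ fj<fi → ≰⇒> (<⇒≱ fj<fi ∘ flatten-mono-≤)) (flatten-mono-< 0<i i≤r)

  len-flatten : len r (flatten σ r) ≡ len r σ
  len-flatten = sum-map-cong (interval 1 r) λ {i} i∈ →
    let 0<i , i≤r = ∈-interval⁻ i∈ in
    count-cong (λ j → flatten σ r j <? flatten σ r i) (λ j → σ j <? σ i) (interval (suc i) r)
               (λ _ → flatten-<⇔ 0<i i≤r)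

increasing-from-ascents : ∀ {f : ℕ → ℕ} {a b} → (∀ {i} → a ≤ i → suc i ≤ b → f i < f (suc i)) →
                          ∀ {i j} → a ≤ i → i < j → j ≤ b → f i < f j
increasing-from-ascents ascent {i} {suc j} a≤i (s≤s i≤j) j<b with m≤n⇒m<n∨m≡n i≤j
... | inj₁ i<j  = <-trans (increasing-from-ascents ascent a≤i i<j (<⇒≤ j<b)) (ascent (≤-trans a≤i i≤j) j<b)
... | inj₂ refl = ascent a≤i j<b

module _ {h : ℕ → ℕ} (hess : IsHessenberg h) {S : ℕ → ℕ → Set} {n} {π : Permutation′ n}
         (inv : InvEq h S n π) {m} (mS : IsMS S m) where

  -- Beyond m every adjacent pair lies in P_h, and none of them is in S.
  seq-increasing-after-m : ∀ {i j} → m < i → i < j → j ≤ n → seq π i < seq π j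
  seq-increasing-after-m = increasing-from-ascents ascent
    where
    ascent : ∀ {i} → m < i → suc i ≤ n → seq π i < seq π (suc i)
    ascent {i} m<i i<n = ≤∧≢⇒< (≮⇒≥ no-descent) (<⇒≢ (n<1+n i) ∘ seq-injective π 0<i (<⇒≤ i<n) z<s i<n)
      where
      0<i : 0 < i
      0<i = <-≤-trans z<s m<i
      no-descent : ¬ seq π (suc i) < seq π i
      no-descent descent = <⇒≱ m<i (proj₂ mS i (Equivalence.from (inv i (suc i))
                                                  (0<i , n<1+n i , proj₂ hess i 0<i , i<n , descent)))

module TailComplement {n} (π : Permutation′ n) {p k} (p≤n : p ≤ n) (k≤n : k ≤ n)
                      (k<tail : ∀ {j} → j ∈ interval (suc p) n → k < seq π j) where

  private
    σ : ℕ → ℕ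
    σ = seq π
    T : List ℕ
    T = interval (suc p) n

  TailValue : ℕ → Set
  TailValue y = Any (λ j → σ j ≡ y) T

  tailValue? : Decidable TailValue
  tailValue? y = any? (λ j → σ j ≟ y) T

  private
    A : ℕ → Bool
    A = tailCompl σ p k n
    A? : ∀ x → Dec (k < x × x ≤ n × ¬ TailValue x)
    A? x = suc k ≤? x ×-dec (x ≤? n ×-dec ¬? (tailValue? x))

  tailValue-seq : ∀ {i} → i ∈ T → TailValue (σ i)
  tailValue-seq i∈T = lose i∈T refl

  ¬tailValue-seq : ∀ {i} → i ∈ interval 1 p → ¬ TailValue (σ i)
  ¬tailValue-seq {i} i∈ tv with find tv | ∈-interval⁻ i∈
  ... | j , j∈T , σj≡σi | 0<i , i≤p with ∈-interval⁻ j∈T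
  ...   | p<j , j≤n = <⇒≱ p<j (subst (_≤ p) (sym j≡i) i≤p)
    where
    j≡i : j ≡ i
    j≡i = seq-injective π (<-≤-trans z<s p<j) j≤n 0<i (≤-trans i≤p p≤n) σj≡σi

  k<tailValue : ∀ {y} → TailValue y → k < y
  k<tailValue tv with find tv
  ... | j , j∈T , refl = k<tail j∈T

  tailCompl-true : ∀ {x} → k < x → x ≤ n → ¬ TailValue x → A x ≡ true
  tailCompl-true {x} k<x x≤n ¬tv = trans (isYes≗does _) (dec-true (A? x) (k<x , x≤n , ¬tv))

  tailCompl-false : ∀ {x} → TailValue x → A x ≡ false
  tailCompl-false {x} tv = trans (isYes≗does _) (dec-false (A? x) (λ (_ , _ , ¬tv) → ¬tv tv))

  tailValue-of-false : ∀ {y} → y ∈ interval (suc k) n → A y ≡ false → TailValue y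
  tailValue-of-false y∈ Ay≡false = decidable-stable (tailValue? _) λ ¬tv →
    let k<y , y≤n = ∈-interval⁻ y∈ in
    contradiction (trans (sym Ay≡false) (tailCompl-true k<y y≤n ¬tv)) λ ()

  below : ℕ → ℕ
  below x = count (λ j → σ j <? x) T

  count-tailValues-below : ∀ x → count (λ y → tailValue? y ×-dec y <? x) (interval (suc k) n) ≡ below x
  count-tailValues-below x = begin
    count Q? (interval (suc k) n)       ≡⟨ count≡sum-indicator Q? (interval (suc k) n) ⟩
    sum (map 𝟙Q (interval (suc k) n))   ≡⟨ sum-map-interval-dropˡ 𝟙Q z≤n k≤n no-small-tail-value ⟨
    sum (map 𝟙Q (interval 1 n))         ≡⟨ sum-map-seq π 𝟙Q ⟨
    sum (map (𝟙Q ∘ σ) (interval 1 n))   ≡⟨ sum-map-interval-dropˡ (𝟙Q ∘ σ) z≤n p≤n no-head-tail-value ⟩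
    sum (map (𝟙Q ∘ σ) T)                ≡⟨ count≡sum-indicator (Q? ∘ σ) T ⟨
    count (Q? ∘ σ) T                    ≡⟨ count-cong (Q? ∘ σ) (λ j → σ j <? x) T
                                                      (λ j∈ → mk⇔ proj₂ (tailValue-seq j∈ ,_)) ⟩
    below x                             ∎
    where
    open ≡-Reasoning
    Q? : Decidable (λ y → TailValue y × y < x)
    Q? y = tailValue? y ×-dec y <? x
    𝟙Q : ℕ → ℕ
    𝟙Q = indicator ∘ Q?
    no-small-tail-value : ∀ {y} → y ∈ interval 1 k → 𝟙Q y ≡ 0
    no-small-tail-value {y} y∈ =
      indicator-reject (Q? y) λ (tv , _) → <⇒≱ (k<tailValue tv) (proj₂ (∈-interval⁻ y∈))
    no-head-tail-value : ∀ {i} → i ∈ interval 1 p → 𝟙Q (σ i) ≡ 0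
    no-head-tail-value {i} i∈ = indicator-reject (Q? (σ i)) (¬tailValue-seq i∈ ∘ proj₁)

  -- The pairs i ≤ p < j with σ j < σ i, counted by the value x = σ i instead of
  -- the position i: the non-tail values are exactly the σ i with i ≤ p.
  contribution : ℕ → ℕ
  contribution x = if does (tailValue? x) then 0 else below x

  contribution-tail : ∀ {x} → TailValue x → contribution x ≡ 0
  contribution-tail {x} tv = cong (if_then 0 else below x) (dec-true (tailValue? x) tv)

  contribution-¬tail : ∀ {x} → ¬ TailValue x → contribution x ≡ below x
  contribution-¬tail {x} ¬tv = cong (if_then 0 else below x) (dec-false (tailValue? x) ¬tv)

  contribution-≤k : ∀ {x} → x ≤ k → contribution x ≡ 0
  contribution-≤k x≤k = trans (contribution-¬tail (λ tv → <⇒≱ (k<tailValue tv) x≤k))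
                              (count-zero _ T λ j∈ σj<x → <⇒≱ (k<tail j∈) (≤-trans (<⇒≤ σj<x) x≤k))

  sum-map-below≡sum-map-contribution :
    sum (map (below ∘ σ) (interval 1 p)) ≡ sum (map contribution (interval (suc k) n))
  sum-map-below≡sum-map-contribution = begin
    sum (map (below ∘ σ) (interval 1 p))         ≡⟨ sum-map-cong (interval 1 p)
                                                                 (sym ∘ contribution-¬tail ∘ ¬tailValue-seq) ⟩
    sum (map (contribution ∘ σ) (interval 1 p))  ≡⟨ sum-map-interval-dropʳ (contribution ∘ σ) z≤n p≤n
                                                                           (contribution-tail ∘ tailValue-seq) ⟨
    sum (map (contribution ∘ σ) (interval 1 n))  ≡⟨ sum-map-seq π contribution ⟩
    sum (map contribution (interval 1 n))        ≡⟨ sum-map-interval-dropˡ contribution z≤n k≤n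
                                                                           (contribution-≤k ∘ proj₂ ∘ ∈-interval⁻) ⟩
    sum (map contribution (interval (suc k) n))  ∎
    where open ≡-Reasoning

  lenInt-summand : ℕ → ℕ
  lenInt-summand x = count (λ y → (A x ≟ᵇ true) ×-dec ((A y ≟ᵇ false) ×-dec (y <? x))) (interval (suc k) n)

  contribution≡lenInt-summand : ∀ {x} → x ∈ interval (suc k) n → contribution x ≡ lenInt-summand x
  contribution≡lenInt-summand {x} x∈ = by-cases (tailValue? x)
    where
    open ≡-Reasoning
    by-cases : Dec (TailValue x) → contribution x ≡ lenInt-summand x
    by-cases (yes tv) = trans (contribution-tail tv) (sym (count-zero _ (interval (suc k) n) λ _ (Ax≡true , _) →
      contradiction (trans (sym Ax≡true) (tailCompl-false tv)) λ ()))
    by-cases (no ¬tv) = begin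
      contribution x                                                ≡⟨ contribution-¬tail ¬tv ⟩
      below x                                                       ≡⟨ count-tailValues-below x ⟨
      count (λ y → tailValue? y ×-dec y <? x) (interval (suc k) n)
        ≡⟨ count-cong _ _ (interval (suc k) n) (λ y∈ → mk⇔
             (λ (tv , y<x) → Ax≡true , tailCompl-false tv , y<x)
             (λ (_ , Ay≡false , y<x) → tailValue-of-false y∈ Ay≡false , y<x)) ⟩
      lenInt-summand x                                              ∎
      where
      Ax≡true : A x ≡ true
      Ax≡true = let k<x , x≤n = ∈-interval⁻ x∈ in tailCompl-true k<x x≤n ¬tv

  sum-map-inversionsWith≡lenInt :
    sum (map (λ i → inversionsWith σ i T) (interval 1 p)) ≡ lenInt (suc k) n (tailCompl σ p k n)
  sum-map-inversionsWith≡lenInt =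
    trans sum-map-below≡sum-map-contribution (sum-map-cong (interval (suc k) n) contribution≡lenInt-summand)

lemma5p3 : (h : ℕ → ℕ) → IsHessenberg h →
    (S : ℕ → ℕ → Set) → Admissible h S → Σ ℕ (λ a → Σ ℕ (λ b → S a b)) →
    (m : ℕ) → IsMS S m →
    (n : ℕ) → h m ≤ n →
    (k : ℕ) → h m ∸ m ≤ k → k ≤ h m →
    (π : Permutation′ n) → InB h S m k n π →
    len n (seq π) ≡ len (h m) (flatten (seq π) (h m)) + lenInt (suc k) n (tailCompl (seq π) (h m) k n)
lemma5p3 h hess _ _ _ m mS n hm≤n k _ k≤hm π (inv , σhm≡k) = begin
  len n σ
    ≡⟨ len-split-increasing-tail σ hm≤n (increasing ∘ <-trans m<hm) ⟩
  len (h m) σ + sum (map (λ i → inversionsWith σ i (interval (suc (h m)) n)) (interval 1 (h m)))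
    ≡⟨ cong₂ _+_ (sym (len-flatten σ (h m)))
                 (TailComplement.sum-map-inversionsWith≡lenInt π hm≤n (≤-trans k≤hm hm≤n) k<tail) ⟩
  len (h m) (flatten σ (h m)) + lenInt (suc k) n (tailCompl σ (h m) k n)
    ∎
  where
  open ≡-Reasoning
  σ : ℕ → ℕ
  σ = seq π
  1≤m : 1 ≤ m
  1≤m = proj₁ (Equivalence.to (inv m (suc m)) (proj₁ mS))
  m<hm : m < h m
  m<hm = proj₂ hess m 1≤m
  increasing : ∀ {i j} → m < i → i < j → j ≤ n → σ i < σ j
  increasing = seq-increasing-after-m hess inv mS
  k<tail : ∀ {j} → j ∈ interval (suc (h m)) n → k < σ j
  k<tail {j} j∈ = let hm<j , j≤n = ∈-interval⁻ j∈ in subst (_< σ j) σhm≡k (increasing m<hm hm<j j≤n)
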